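{- Consider a finite protocol instance $\hat{\mathcal{P}}$ with symmetry group $G$, initial-state formula $\hat{Init}$, transition relation $\hat{T}$ and safety property $\hat{P}$, satisfying $\hat{Init}^{\gamma}\equiv\hat{Init}$, $\hat{T}^{\gamma}\equiv\hat{T}$ and $\hat{P}^{\gamma}\equiv\hat{P}$ for every $\gamma\in G$. Let $F_0,F_1,\dots$ be the frames maintained by the SymIC3 algorithm on $\hat{\mathcal{P}}$. Then at every point of the algorithm, for every frame $F_i$ and every $\gamma\in G$, $F_i^{\gamma}\equiv F_i$.
   Context: A finite protocol instance has finitely many sorts $\mathsf{s}_1,\dots,\mathsf{s}_n$, each a finite set of distinct constants (some sorts may be dependent, e.g. a sort whose constants are named subsets of another sort's constants, in which case permutations of the underlying sort act on it in the induced way). The state variables are Boolean variables of the form $r(c_1,\dots,c_k)$, i.e. protocol relations instantiated with sort constants; primed copies denote next-state variables. The symmetry group is $G=\prod_{\mathsf{s}} Sym(\mathsf{s})$, the product of the full symmetric groups on the (independent) sorts. For $\gamma\in G$ and a formula $\psi$ over the state variables, $\psi^{\gamma}$ is obtained by replacing every sort constant $c$ in $\psi$ by $\gamma(c)$. For a clause $\varphi$ (a disjunction of literals over state variables), its logical orbit is $\varphi^{L(G)}=\bigwedge_{\gamma\in G}\varphi^{\gamma}$ (the conjunction of its logically distinct images). SymIC3 is IC3/PDR with symmetry boosting: $F_0=\hat{Init}$; each frame $F_i$ with $i>0$ is initialized to $\hat{P}$; and whenever a clause $\varphi$ is learned in frame $F_i$ (because the query $F_{i-1}\wedge\hat{T}\wedge\neg\varphi'$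 is unsatisfiable), the frame is updated as $F_i:=F_i\wedge\varphi^{L(G)}$ rather than $F_i\wedge\varphi$. -}

module Defs where

open import Data.Nat using (ℕ; suc)
open import Data.Fin using (Fin; zero; suc; inject₁)
open import Data.Fin.Subset using (Subset)
open import Data.Fin.Permutation using (Permutation′; _⟨$⟩ʳ_; _⟨$⟩ˡ_)
open import Data.Vec using (Vec; []; _∷_; tabulate; lookup; _[_]≔_; _∷ʳ_)
open import Data.List using (List; []; _∷_)
open import Data.Bool using (Bool; true; false; T)
open import Data.Unit using (⊤; tt)
open import Data.Empty using (⊥)
open import Data.Product using (Σ; _×_; _,_)
open import Data.Sum using (_⊎_; inj₁; inj₂; [_,_])
open import Relation.Nullary using (¬_)
open import Relation.Binary.PropositionalEquality using (_≡_)
open import Function.Bundles using (_⇔_)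

-- The extra constructor
-- ⋀ is a conjunction indexed by an index type I (instantiated with the
-- finite symmetry group G); it is used to write logical orbits
-- φ^{L(G)} = ⋀_{γ ∈ G} φ^γ.

data Formula (I : Set) (A : Set) : Set where
  atom : A → Formula I A
  tru  : Formula I A
  fls  : Formula I A
  neg  : Formula I A → Formula I A
  _∧_  : Formula I A → Formula I A → Formula I A
  _∨_  : Formula I A → Formula I A → Formula I A
  ⋀    : (I → Formula I A) → Formula I A

rename : ∀ {I A B} → (A → B) → Formula I A → Formula I B
rename f (atom x) = atom (f x)
rename f tru      = tru
rename f fls      = fls
rename f (neg ψ)  = neg (rename f ψ)
rename f (ψ ∧ χ)  = rename f ψ ∧ rename f χ
rename f (ψ ∨ χ)  = rename f ψ ∨ rename f χ
rename f (⋀ h)    = ⋀ (λ i → rename f (h i))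

⟦_⟧ : ∀ {I A} → Formula I A → (A → Bool) → Set
⟦ atom x ⟧ v = T (v x)
⟦ tru ⟧    v = ⊤
⟦ fls ⟧    v = ⊥
⟦ neg ψ ⟧  v = ¬ ⟦ ψ ⟧ v
⟦ ψ ∧ χ ⟧  v = ⟦ ψ ⟧ v × ⟦ χ ⟧ v
⟦ ψ ∨ χ ⟧  v = ⟦ ψ ⟧ v ⊎ ⟦ χ ⟧ v
⟦ ⋀ h ⟧    v = ∀ i → ⟦ h i ⟧ v

_≋_ : ∀ {I A} → Formula I A → Formula I A → Set
ψ ≋ χ = ∀ v → ⟦ ψ ⟧ v ⇔ ⟦ χ ⟧ v

Unsat : ∀ {I A} → Formula I A → Set
Unsat ψ = ∀ v → ¬ ⟦ ψ ⟧ v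

Literal : Set → Set
Literal A = Bool × A

Clause : Set → Set
Clause A = List (Literal A)

litF : ∀ {I A} → Literal A → Formula I A
litF (true  , x) = atom x
litF (false , x) = neg (atom x)

clauseF : ∀ {I A} → Clause A → Formula I A
clauseF []      = fls
clauseF (l ∷ c) = litF l ∨ clauseF c

-- Independent (base) sorts b have constants Fin (size b).
-- Dependent sorts d have constants Fin (nConst d), each naming a subset
-- of the constants of the underlying base sort (under d); distinct
-- constants name distinct subsets.  The induced action of a permutation
-- π of the underlying sort maps the constant naming S to the constant
-- naming π[S] (the family of named subsets is closed under this).

image : ∀ {k} → Permutation′ k → Subset k → Subset k
image π S = tabulate (λ x → lookup S (π ⟨$⟩ˡ x))

record Sorts : Set where
  field
    nB       : ℕ
    size     : Fin nB → ℕ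
    nD       : ℕ
    under    : Fin nD → Fin nB
    nConst   : Fin nD → ℕ
    named    : (d : Fin nD) → Fin (nConst d) → Subset (size (under d))
    named-inj : ∀ d {c c′} → named d c ≡ named d c′ → c ≡ c′
    permD    : (d : Fin nD) → Permutation′ (size (under d)) →
               Fin (nConst d) → Fin (nConst d)
    permD-spec : ∀ d π c → named d (permD d π c) ≡ image π (named d c)

  Sort : Set
  Sort = Fin nB ⊎ Fin nD

  Const : Sort → Set
  Const (inj₁ b) = Fin (size b)
  Const (inj₂ d) = Fin (nConst d)

  G : Set
  G = (b : Fin nB) → Permutation′ (size b)

  actC : G → (s : Sort) → Const s → Const s
  actC γ (inj₁ b) c = γ b ⟨$⟩ʳ c
  actC γ (inj₂ d) c = permD d (γ (under d)) c

  Args : List Sort → Set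
  Args []       = ⊤
  Args (s ∷ ss) = Const s × Args ss

  actArgs : G → (ss : List Sort) → Args ss → Args ss
  actArgs γ []       tt       = tt
  actArgs γ (s ∷ ss) (c , cs) = actC γ s c , actArgs γ ss cs

record Instance : Set₁ where
  field
    sorts : Sorts
  open Sorts sorts public
  field
    nR    : ℕ
    arity : Fin nR → List Sort

  Var : Set
  Var = Σ (Fin nR) (λ r → Args (arity r))

  actV : G → Var → Var
  actV γ (r , cs) = r , actArgs γ (arity r) cs

  -- state formulas and transition formulas (inj₁ = current, inj₂ = primed)
  SF : Set
  SF = Formula G Var

  TF : Set
  TF = Formula G (Var ⊎ Var)

  _^_ : SF → G → SF
  ψ ^ γ = rename (actV γ) ψ

  _^ᵀ_ : TF → G → TF
  τ ^ᵀ γ = rename [ (λ x → inj₁ (actV γ x)) , (λ x → inj₂ (actV γ x)) ] τ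

  orbit : Clause Var → SF
  orbit φ = ⋀ (λ γ → clauseF φ ^ γ)

  unprimed : SF → TF
  unprimed = rename inj₁

  primed : SF → TF
  primed = rename inj₂

  field
    Init : SF
    Trans : TF
    Prop : SF

module _ (𝒫 : Instance) where
  open Instance 𝒫

  data SymIC3Frames : (k : ℕ) → Vec SF (suc k) → Set where
    start  : SymIC3Frames 0 (Init ∷ [])
    extend : ∀ {k Fs} → SymIC3Frames k Fs → SymIC3Frames (suc k) (Fs ∷ʳ Prop)
    learn  : ∀ {k Fs} → SymIC3Frames k Fs →
             (j : Fin k) (φ : Clause Var) →
             Unsat (unprimed (lookup Fs (inject₁ j)) ∧ (Trans ∧ neg (primed (clauseF φ)))) →
             SymIC3Frames k (Fs [ suc j ]≔ (lookup Fs (suc j) ∧ orbit φ))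

{-# OPTIONS --safe #-}
-- A frame only ever grows by conjoining Init, P, or a whole logical orbit
-- φ^{L(G)}.  Init and P are symmetric by hypothesis, and an orbit is symmetric
-- because applying γ to ⋀_δ φ^δ only reindexes the conjunction along the
-- bijection δ ↦ γ·δ of G.  Symmetry is preserved by conjunction, so every
-- frame stays symmetric by induction on the run.
module Submission where

open import Defs
open import Data.Nat using (ℕ; suc)
open import Data.Fin using (Fin; zero; suc)
open import Data.Fin.Subset using (Subset)
open import Data.Fin.Permutation using (Permutation′; _⟨$⟩ˡ_; _∘ₚ_; flip; inverseʳ)
open import Data.Vec using (Vec; lookup; tabulate; _[_]≔_; _∷ʳ_)
open import Data.Vec.Properties using (tabulate-cong; tabulate∘lookup; lookup∘tabulate)
open import Data.Vec.Relation.Unary.All using (All; []; _∷_)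
open import Data.Vec.Relation.Unary.All.Properties using (lookup⁺)
open import Data.List using ([]; _∷_)
open import Data.Bool using (Bool; T)
open import Data.Unit using (tt)
open import Data.Product using (_,_)
open import Data.Product.Function.NonDependent.Propositional using (_×-⇔_)
open import Data.Sum using (inj₁; inj₂)
open import Data.Sum.Function.Propositional using (_⊎-⇔_)
open import Function using (_∘_)
open import Function.Bundles using (_⇔_; mk⇔; module Equivalence)
open import Function.Construct.Identity using (⇔-id)
open import Function.Properties.Equivalence using (⇔-setoid)
open import Function.Related.TypeIsomorphisms using (¬-cong-⇔)
open import Level using (0ℓ)
open import Relation.Binary.PropositionalEquality
  using (_≡_; refl; cong; cong₂; subst; module ≡-Reasoning)

module _ {I : Set} where

  ⟦rename⟧ : ∀ {A B} (f : A → B) (ψ : Formula I A) {v : B → Bool} {w : A → Bool} →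
             (∀ x → v (f x) ≡ w x) → ⟦ rename f ψ ⟧ v ⇔ ⟦ ψ ⟧ w
  ⟦rename⟧ f (atom x) e = subst (λ b → T _ ⇔ T b) (e x) (⇔-id _)
  ⟦rename⟧ f tru      e = ⇔-id _
  ⟦rename⟧ f fls      e = ⇔-id _
  ⟦rename⟧ f (neg ψ)  e = ¬-cong-⇔ (⟦rename⟧ f ψ e)
  ⟦rename⟧ f (ψ ∧ χ)  e = ⟦rename⟧ f ψ e ×-⇔ ⟦rename⟧ f χ e
  ⟦rename⟧ f (ψ ∨ χ)  e = ⟦rename⟧ f ψ e ⊎-⇔ ⟦rename⟧ f χ e
  ⟦rename⟧ f (⋀ h)    e = mk⇔ (λ p i → to (⟦rename⟧ f (h i) e) (p i))
                              (λ p i → from (⟦rename⟧ f (h i) e) (p i))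
    where open Equivalence

  rename-rename-≋ : ∀ {A B C} (f : B → C) (g : A → B) (h : A → C) →
                    (∀ x → f (g x) ≡ h x) → (ψ : Formula I A) →
                    rename f (rename g ψ) ≋ rename h ψ
  rename-rename-≋ f g h fg≗h ψ v = begin
    ⟦ rename f (rename g ψ) ⟧ v  ≈⟨ ⟦rename⟧ f (rename g ψ) (λ _ → refl) ⟩
    ⟦ rename g ψ ⟧ (v ∘ f)       ≈⟨ ⟦rename⟧ g ψ (λ x → cong v (fg≗h x)) ⟩
    ⟦ ψ ⟧ (v ∘ h)                ≈⟨ ⟦rename⟧ h ψ (λ _ → refl) ⟨
    ⟦ rename h ψ ⟧ v             ∎
    where open import Relation.Binary.Reasoning.Setoid (⇔-setoid 0ℓ)

module _ {A : Set} {P : A → Set} where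

  ∷ʳ⁺ : ∀ {n} {xs : Vec A n} {x} → All P xs → P x → All P (xs ∷ʳ x)
  ∷ʳ⁺ []         px = px ∷ []
  ∷ʳ⁺ (py ∷ pys) px = py ∷ ∷ʳ⁺ pys px

  []≔⁺ : ∀ {n} {xs : Vec A n} {x} (i : Fin n) → All P xs → P x → All P (xs [ i ]≔ x)
  []≔⁺ zero    (_ ∷ pys)  px = px ∷ pys
  []≔⁺ (suc i) (py ∷ pys) px = py ∷ []≔⁺ i pys px

module _ {k : ℕ} where

  image-∘ₚ : (π σ : Permutation′ k) (S : Subset k) → image π (image σ S) ≡ image (σ ∘ₚ π) S
  image-∘ₚ π σ S = tabulate-cong (λ x → lookup∘tabulate _ (π ⟨$⟩ˡ x))

  image-flip : (π : Permutation′ k) (S : Subset k) → image π (image (flip π) S) ≡ S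
  image-flip π S = begin
    tabulate (λ x → lookup (tabulate (λ y → lookup S (flip π ⟨$⟩ˡ y))) (π ⟨$⟩ˡ x))
      ≡⟨ tabulate-cong (λ x → lookup∘tabulate _ (π ⟨$⟩ˡ x)) ⟩
    tabulate (λ x → lookup S (flip π ⟨$⟩ˡ (π ⟨$⟩ˡ x)))
      ≡⟨ tabulate-cong (λ x → cong (lookup S) (inverseʳ π)) ⟩
    tabulate (lookup S)
      ≡⟨ tabulate∘lookup S ⟩
    S ∎
    where open ≡-Reasoning

module SortsAction (𝒮 : Sorts) where
  open Sorts 𝒮

  permD-∘ₚ : ∀ d π σ c → permD d π (permD d σ c) ≡ permD d (σ ∘ₚ π) c
  permD-∘ₚ d π σ c = named-inj d (begin
    named d (permD d π (permD d σ c))  ≡⟨ permD-spec d π _ ⟩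
    image π (named d (permD d σ c))    ≡⟨ cong (image π) (permD-spec d σ c) ⟩
    image π (image σ (named d c))      ≡⟨ image-∘ₚ π σ (named d c) ⟩
    image (σ ∘ₚ π) (named d c)         ≡⟨ permD-spec d (σ ∘ₚ π) c ⟨
    named d (permD d (σ ∘ₚ π) c)       ∎)
    where open ≡-Reasoning

  permD-flip : ∀ d π c → permD d π (permD d (flip π) c) ≡ c
  permD-flip d π c = named-inj d (begin
    named d (permD d π (permD d (flip π) c))  ≡⟨ permD-spec d π _ ⟩
    image π (named d (permD d (flip π) c))    ≡⟨ cong (image π) (permD-spec d (flip π) c) ⟩
    image π (image (flip π) (named d c))      ≡⟨ image-flip π (named d c) ⟩
    named d c                                 ∎)
    where open ≡-Reasoning

  infixl 7 _·_
  _·_ : G → G → G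
  (γ · δ) b = δ b ∘ₚ γ b

  _⁻¹ : G → G
  (γ ⁻¹) b = flip (γ b)

  actC-· : ∀ γ δ s c → actC γ s (actC δ s c) ≡ actC (γ · δ) s c
  actC-· γ δ (inj₁ b) c = refl
  actC-· γ δ (inj₂ d) c = permD-∘ₚ d (γ (under d)) (δ (under d)) c

  actC-⁻¹ : ∀ γ s c → actC γ s (actC (γ ⁻¹) s c) ≡ c
  actC-⁻¹ γ (inj₁ b) c = inverseʳ (γ b)
  actC-⁻¹ γ (inj₂ d) c = permD-flip d (γ (under d)) c

  actArgs-· : ∀ γ δ ss cs → actArgs γ ss (actArgs δ ss cs) ≡ actArgs (γ · δ) ss cs
  actArgs-· γ δ []       tt       = refl
  actArgs-· γ δ (s ∷ ss) (c , cs) = cong₂ _,_ (actC-· γ δ s c) (actArgs-· γ δ ss cs)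

  actArgs-⁻¹ : ∀ γ ss cs → actArgs γ ss (actArgs (γ ⁻¹) ss cs) ≡ cs
  actArgs-⁻¹ γ []       tt       = refl
  actArgs-⁻¹ γ (s ∷ ss) (c , cs) = cong₂ _,_ (actC-⁻¹ γ s c) (actArgs-⁻¹ γ ss cs)

module InstanceSymmetry (𝒫 : Instance) where
  open Instance 𝒫
  open SortsAction sorts

  actV-· : ∀ γ δ x → actV γ (actV δ x) ≡ actV (γ · δ) x
  actV-· γ δ (r , cs) = cong (r ,_) (actArgs-· γ δ (arity r) cs)

  actV-cancelˡ : ∀ γ δ x → actV γ (actV (γ ⁻¹ · δ) x) ≡ actV δ x
  actV-cancelˡ γ δ (r , cs) = cong (r ,_) (begin
    actArgs γ (arity r) (actArgs (γ ⁻¹ · δ) (arity r) cs)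
      ≡⟨ cong (actArgs γ (arity r)) (actArgs-· (γ ⁻¹) δ (arity r) cs) ⟨
    actArgs γ (arity r) (actArgs (γ ⁻¹) (arity r) (actArgs δ (arity r) cs))
      ≡⟨ actArgs-⁻¹ γ (arity r) (actArgs δ (arity r) cs) ⟩
    actArgs δ (arity r) cs ∎)
    where open ≡-Reasoning

  Symmetric : SF → Set
  Symmetric ψ = ∀ γ → (ψ ^ γ) ≋ ψ

  ∧-symmetric : ∀ ψ χ → Symmetric ψ → Symmetric χ → Symmetric (ψ ∧ χ)
  ∧-symmetric ψ χ ψ-sym χ-sym γ v = ψ-sym γ v ×-⇔ χ-sym γ v

  orbit-symmetric : ∀ φ → Symmetric (orbit φ)
  orbit-symmetric φ γ v = mk⇔
    (λ p δ → to   (^-^≋ (actV-cancelˡ γ δ) v) (p (γ ⁻¹ · δ)))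
    (λ p δ → from (^-^≋ (actV-· γ δ) v)       (p (γ · δ)))
    where
    open Equivalence
    ^-^≋ : ∀ {δ ε} → (∀ x → actV γ (actV δ x) ≡ actV ε x) → ((clauseF φ ^ δ) ^ γ) ≋ (clauseF φ ^ ε)
    ^-^≋ {δ} {ε} e = rename-rename-≋ (actV γ) (actV δ) (actV ε) e (clauseF φ)

  frames-symmetric : Symmetric Init → Symmetric Prop →
                     ∀ {k Fs} → SymIC3Frames 𝒫 k Fs → All Symmetric Fs
  frames-symmetric Init-sym Prop-sym start = Init-sym ∷ []
  frames-symmetric Init-sym Prop-sym (extend run) =
    ∷ʳ⁺ (frames-symmetric Init-sym Prop-sym run) Prop-sym
  frames-symmetric Init-sym Prop-sym (learn {Fs = Fs} run j φ _) =
    []≔⁺ (suc j) Fs-sym (∧-symmetric (lookup Fs (suc j)) (orbit φ) (lookup⁺ Fs-sym (suc j)) (orbit-symmetric φ))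
    where Fs-sym = frames-symmetric Init-sym Prop-sym run

lemma1 : (𝒫 : Instance) →
    let open Instance 𝒫 in
    (∀ γ → (Init ^ γ) ≋ Init) →
    (∀ γ → (Trans ^ᵀ γ) ≋ Trans) →
    (∀ γ → (Prop ^ γ) ≋ Prop) →
    ∀ (k : ℕ) (Fs : Vec SF (suc k)) → SymIC3Frames 𝒫 k Fs →
    ∀ (i : Fin (suc k)) (γ : G) → (lookup Fs i ^ γ) ≋ lookup Fs i
lemma1 𝒫 Init-sym _ Prop-sym k Fs run =
  lookup⁺ (frames-symmetric Init-sym Prop-sym run)
  where open InstanceSymmetry 𝒫
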